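{- Let $\Delta$ be a finite abstract simplicial complex on $V$ and $\kappa\colon V\to[k]$ a surjective map. Then $\kappa$ is a $k$-linear coloring of $\Delta$ if and only if for every pair of facets $(F_1,F_2)$ of $\Delta$ there is no pair of vertices $(v_1,v_2)$ with $\kappa(v_1)=\kappa(v_2)$, $v_1\in F_1\setminus F_2$ and $v_2\in F_2\setminus F_1$.
   Context: $[k]=\{1,\dots,k\}$; facets are maximal faces. For a face $S$, $S_\kappa$ is the multiset on $[k]$ (function $[k]\to\mathbb{N}$) with $S_\kappa(t)=|\{v\in S:\kappa(v)=t\}|$; for multisets $\|M\|=\sum_tM(t)$ and $(M\cap M')(t)=\min(M(t),M'(t))$. A $k$-linear coloring of $\Delta$ is a surjective $\kappa\colon V\to[k]$ with $\|F_\kappa\cap F'_\kappa\|=|F\cap F'|$ for all facets $F,F'$. -}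

module Defs where

open import Data.Nat using (ℕ; zero; suc; _+_; _⊓_)
open import Data.Fin using (Fin; zero; suc; _≟_)
open import Data.Fin.Subset using (Subset; _∈_; _⊆_; ⁅_⁆; _∩_; ∣_∣)
open import Data.Vec using (lookup)
open import Data.Bool using (Bool; true; false; _∧_)
open import Data.Product using (Σ; _×_; ∃)
open import Relation.Nullary using (does)
open import Relation.Binary.PropositionalEquality using (_≡_)

sumFin : {k : ℕ} → (Fin k → ℕ) → ℕ
sumFin {zero}  f = 0
sumFin {suc k} f = f zero + sumFin {k} (λ i → f (suc i))

record SimplicialComplex (n : ℕ) : Set₁ where
  field
    Face        : Subset n → Set
    down-closed : ∀ {S T} → T ⊆ S → Face S → Face T
    singletons  : ∀ v → Face ⁅ v ⁆
open SimplicialComplex public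

IsFacet : {n : ℕ} → SimplicialComplex n → Subset n → Set
IsFacet Δ F = Face Δ F × (∀ G → Face Δ G → F ⊆ G → G ≡ F)

Multiset : ℕ → Set
Multiset k = Fin k → ℕ

colorMultiset : {n k : ℕ} → (Fin n → Fin k) → Subset n → Multiset k
colorMultiset κ S t = sumFin (λ v → if-true (lookup S v ∧ does (κ v ≟ t)))
  where
  if-true : Bool → ℕ
  if-true true  = 1
  if-true false = 0

‖_‖ : {k : ℕ} → Multiset k → ℕ
‖ M ‖ = sumFin M

_∩ₘ_ : {k : ℕ} → Multiset k → Multiset k → Multiset k
(M ∩ₘ M') t = M t ⊓ M' t

Surjective : {n k : ℕ} → (Fin n → Fin k) → Set
Surjective {n} κ = ∀ t → Σ (Fin n) (λ v → κ v ≡ t)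

IsLinearColoring : {n : ℕ} (k : ℕ) → SimplicialComplex n → (Fin n → Fin k) → Set
IsLinearColoring k Δ κ =
  Surjective κ ×
  (∀ F F' → IsFacet Δ F → IsFacet Δ F' →
     ‖ colorMultiset κ F ∩ₘ colorMultiset κ F' ‖ ≡ ∣ F ∩ F' ∣)

-- Split the colour multisets of two facets along F ∩ F': pointwise
-- F_κ ∩ F'_κ = (F ∩ F')_κ + ((F ∖ F')_κ ∩ (F' ∖ F)_κ), and the first summand has
-- total size ∣ F ∩ F' ∣ because every vertex carries exactly one colour. So the
-- linearity condition for F, F' holds iff the colour multisets of F ∖ F' and
-- F' ∖ F are disjoint, i.e. iff no colour occurs on both sides. Neither maximality
-- of the faces nor surjectivity of κ plays a role.
module Submission where

open import Defs
open import Data.Nat using (ℕ; zero; suc; _+_; _⊓_)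
open import Data.Nat.Properties
  using (+-identityʳ; +-distribˡ-⊓; ⊓-zeroʳ; +-cancelˡ-≡; m+n≡0⇒m≡0; m+n≡0⇒n≡0; +-commutativeSemigroup)
open import Algebra.Properties.CommutativeSemigroup +-commutativeSemigroup using (interchange)
open import Data.Fin using (Fin; zero; suc; _≟_)
open import Data.Fin.Subset using (Subset; _∈_; _∉_; _∩_; ∁; ∣_∣; inside)
open import Data.Fin.Subset.Properties using (∩-comm; x∈p∩q⁺; x∈p∩q⁻; x∉p⇒x∈∁p; x∈∁p⇒x∉p)
open import Data.Vec.Base using ([]; _∷_; here; there)
open import Data.Bool using (Bool; true; false; _∧_; not)
open import Data.Product as Product using (Σ; _×_; _,_)
open import Data.Empty using (⊥-elim)
open import Data.Sum as Sum using (_⊎_; inj₁; inj₂)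
open import Function using (_∘_)
open import Function.Bundles using (_⇔_; mk⇔; Equivalence)
open import Relation.Nullary using (¬_; does; yes; no)
open import Relation.Binary.PropositionalEquality
  using (_≡_; _≢_; refl; sym; trans; cong; cong₂; module ≡-Reasoning)

open ≡-Reasoning

indicator : Bool → ℕ
indicator true  = 1
indicator false = 0

indicator-∧-split : ∀ x y c →
  indicator (x ∧ c) ≡ indicator ((x ∧ y) ∧ c) + indicator ((x ∧ not y) ∧ c)
indicator-∧-split false y     c     = refl
indicator-∧-split true  false c     = refl
indicator-∧-split true  true  true  = refl
indicator-∧-split true  true  false = refl

m⊓n≡0⇒m≡0⊎n≡0 : ∀ m n → m ⊓ n ≡ 0 → m ≡ 0 ⊎ n ≡ 0
m⊓n≡0⇒m≡0⊎n≡0 zero    n       _ = inj₁ refl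
m⊓n≡0⇒m≡0⊎n≡0 (suc m) zero    _ = inj₂ refl

sumFin-cong : ∀ {k} {f g : Fin k → ℕ} → (∀ i → f i ≡ g i) → sumFin f ≡ sumFin g
sumFin-cong {zero}  f≗g = refl
sumFin-cong {suc k} f≗g = cong₂ _+_ (f≗g zero) (sumFin-cong (f≗g ∘ suc))

sumFin-distrib-+ : ∀ {k} (f g : Fin k → ℕ) →
  sumFin (λ i → f i + g i) ≡ sumFin f + sumFin g
sumFin-distrib-+ {zero}  f g = refl
sumFin-distrib-+ {suc k} f g = begin
  (f zero + g zero) + sumFin (λ i → f (suc i) + g (suc i))
    ≡⟨ cong (f zero + g zero +_) (sumFin-distrib-+ (f ∘ suc) (g ∘ suc)) ⟩
  (f zero + g zero) + (sumFin (f ∘ suc) + sumFin (g ∘ suc))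
    ≡⟨ interchange (f zero) (g zero) _ _ ⟩
  (f zero + sumFin (f ∘ suc)) + (g zero + sumFin (g ∘ suc))
    ∎

sumFin-zero : ∀ {k} {f : Fin k → ℕ} → (∀ i → f i ≡ 0) → sumFin f ≡ 0
sumFin-zero {zero}  f≗0 = refl
sumFin-zero {suc k} f≗0 = cong₂ _+_ (f≗0 zero) (sumFin-zero (f≗0 ∘ suc))

sumFin≡0⇒≡0 : ∀ {k} (f : Fin k → ℕ) → sumFin f ≡ 0 → ∀ i → f i ≡ 0
sumFin≡0⇒≡0 f Σf≡0 zero    = m+n≡0⇒m≡0 (f zero) Σf≡0
sumFin≡0⇒≡0 f Σf≡0 (suc i) = sumFin≡0⇒≡0 (f ∘ suc) (m+n≡0⇒n≡0 (f zero) Σf≡0) i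

sumFin-indicator-≟ : ∀ {k} (c : Fin k) → sumFin (λ t → indicator (does (c ≟ t))) ≡ 1
sumFin-indicator-≟ {suc k} zero    = cong suc (sumFin-zero {k} λ _ → refl)
sumFin-indicator-≟ {suc k} (suc c) = trans (sumFin-cong suc≟suc) (sumFin-indicator-≟ c)
  where
  suc≟suc : ∀ t → indicator (does (suc c ≟ suc t)) ≡ indicator (does (c ≟ t))
  suc≟suc t with c ≟ t
  ... | yes _ = refl
  ... | no  _ = refl

-- Defs counts with its own local indicator; the `with` identifies it with `indicator`.
colorMultiset-∷ : ∀ {n k} (κ : Fin (suc n) → Fin k) b (S : Subset n) t →
  colorMultiset κ (b ∷ S) t ≡ indicator (b ∧ does (κ zero ≟ t)) + colorMultiset (κ ∘ suc) S t
colorMultiset-∷ κ b S t with b ∧ does (κ zero ≟ t)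
... | true  = refl
... | false = refl

‖colorMultiset‖≡∣∣ : ∀ {n k} (κ : Fin n → Fin k) (S : Subset n) → ‖ colorMultiset κ S ‖ ≡ ∣ S ∣
‖colorMultiset‖≡∣∣ {k = k} κ [] = sumFin-zero {k} λ _ → refl
‖colorMultiset‖≡∣∣ {k = k} κ (b ∷ S) = begin
  ‖ colorMultiset κ (b ∷ S) ‖
    ≡⟨ sumFin-cong (colorMultiset-∷ κ b S) ⟩
  sumFin (λ t → indicator (b ∧ does (κ zero ≟ t)) + colorMultiset (κ ∘ suc) S t)
    ≡⟨ sumFin-distrib-+ (λ t → indicator (b ∧ does (κ zero ≟ t))) (colorMultiset (κ ∘ suc) S) ⟩
  sumFin (λ t → indicator (b ∧ does (κ zero ≟ t))) + ‖ colorMultiset (κ ∘ suc) S ‖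
    ≡⟨ cong₂ _+_ (head-count b) (‖colorMultiset‖≡∣∣ (κ ∘ suc) S) ⟩
  indicator b + ∣ S ∣
    ≡⟨ ∣∷∣ b ⟩
  ∣ b ∷ S ∣
    ∎
  where
  ∣∷∣ : ∀ b → indicator b + ∣ S ∣ ≡ ∣ b ∷ S ∣
  ∣∷∣ true  = refl
  ∣∷∣ false = refl

  head-count : ∀ b → sumFin (λ t → indicator (b ∧ does (κ zero ≟ t))) ≡ indicator b
  head-count true  = sumFin-indicator-≟ (κ zero)
  head-count false = sumFin-zero {k} λ _ → refl

colorMultiset-∩-∁ : ∀ {n k} (κ : Fin n → Fin k) (S T : Subset n) t →
  colorMultiset κ S t ≡ colorMultiset κ (S ∩ T) t + colorMultiset κ (S ∩ ∁ T) t
colorMultiset-∩-∁ κ []      []      t = refl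
colorMultiset-∩-∁ κ (x ∷ S) (y ∷ T) t = begin
  colorMultiset κ (x ∷ S) t
    ≡⟨ colorMultiset-∷ κ x S t ⟩
  indicator (x ∧ c) + colorMultiset κ′ S t
    ≡⟨ cong₂ _+_ (indicator-∧-split x y c) (colorMultiset-∩-∁ κ′ S T t) ⟩
  (indicator ((x ∧ y) ∧ c) + indicator ((x ∧ not y) ∧ c)) +
  (colorMultiset κ′ (S ∩ T) t + colorMultiset κ′ (S ∩ ∁ T) t)
    ≡⟨ interchange (indicator ((x ∧ y) ∧ c)) _ (colorMultiset κ′ (S ∩ T) t) _ ⟩
  (indicator ((x ∧ y) ∧ c) + colorMultiset κ′ (S ∩ T) t) +
  (indicator ((x ∧ not y) ∧ c) + colorMultiset κ′ (S ∩ ∁ T) t)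
    ≡⟨ sym (cong₂ _+_ (colorMultiset-∷ κ (x ∧ y) (S ∩ T) t)
                      (colorMultiset-∷ κ (x ∧ not y) (S ∩ ∁ T) t)) ⟩
  colorMultiset κ ((x ∷ S) ∩ (y ∷ T)) t + colorMultiset κ ((x ∷ S) ∩ ∁ (y ∷ T)) t
    ∎
  where
  c = does (κ zero ≟ t)
  κ′ = κ ∘ suc

‖∩ₘ‖≡∣∩∣+excess : ∀ {n k} (κ : Fin n → Fin k) (S T : Subset n) →
  ‖ colorMultiset κ S ∩ₘ colorMultiset κ T ‖ ≡
  ∣ S ∩ T ∣ + ‖ colorMultiset κ (S ∩ ∁ T) ∩ₘ colorMultiset κ (T ∩ ∁ S) ‖
‖∩ₘ‖≡∣∩∣+excess κ S T = begin
  ‖ colorMultiset κ S ∩ₘ colorMultiset κ T ‖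
    ≡⟨ sumFin-cong pointwise ⟩
  sumFin (λ t → common t + excess t)
    ≡⟨ sumFin-distrib-+ common excess ⟩
  ‖ common ‖ + ‖ excess ‖
    ≡⟨ cong (_+ ‖ excess ‖) (‖colorMultiset‖≡∣∣ κ (S ∩ T)) ⟩
  ∣ S ∩ T ∣ + ‖ excess ‖
    ∎
  where
  common = colorMultiset κ (S ∩ T)
  excess = colorMultiset κ (S ∩ ∁ T) ∩ₘ colorMultiset κ (T ∩ ∁ S)
  pointwise : ∀ t → colorMultiset κ S t ⊓ colorMultiset κ T t ≡ common t + excess t
  pointwise t = begin
    colorMultiset κ S t ⊓ colorMultiset κ T t
      ≡⟨ cong₂ _⊓_ (colorMultiset-∩-∁ κ S T t) (colorMultiset-∩-∁ κ T S t) ⟩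
    (common t + colorMultiset κ (S ∩ ∁ T) t) ⊓ (colorMultiset κ (T ∩ S) t + colorMultiset κ (T ∩ ∁ S) t)
      ≡⟨ cong (λ U → (common t + colorMultiset κ (S ∩ ∁ T) t) ⊓ (colorMultiset κ U t + colorMultiset κ (T ∩ ∁ S) t))
                (∩-comm T S) ⟩
    (common t + colorMultiset κ (S ∩ ∁ T) t) ⊓ (common t + colorMultiset κ (T ∩ ∁ S) t)
      ≡⟨ +-distribˡ-⊓ (common t) _ _ ⟨
    common t + excess t
      ∎

colorMultiset≡0⇒≢ : ∀ {n k} (κ : Fin n → Fin k) {S : Subset n} {v t} →
  colorMultiset κ S t ≡ 0 → v ∈ S → κ v ≢ t
colorMultiset≡0⇒≢ κ {inside ∷ S} {zero} {t} Sₜ≡0 here κv≡t =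
  positive (trans (sym (colorMultiset-∷ κ inside S t)) Sₜ≡0)
  where
  positive : indicator (does (κ zero ≟ t)) + colorMultiset (κ ∘ suc) S t ≢ 0
  positive with κ zero ≟ t
  ... | yes _      = λ ()
  ... | no  κ0≢t   = λ _ → κ0≢t κv≡t
colorMultiset≡0⇒≢ κ {b ∷ S} {suc v} {t} Sₜ≡0 (there v∈S) =
  colorMultiset≡0⇒≢ (κ ∘ suc) {S}
    (m+n≡0⇒n≡0 (indicator (b ∧ does (κ zero ≟ t))) (trans (sym (colorMultiset-∷ κ b S t)) Sₜ≡0))
    v∈S

witness-suc : ∀ {n k} {κ : Fin (suc n) → Fin k} {b S t} →
  Σ (Fin n) (λ v → v ∈ S × κ (suc v) ≡ t) → Σ (Fin (suc n)) (λ v → v ∈ b ∷ S × κ v ≡ t)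
witness-suc (v , v∈S , κv≡t) = suc v , there v∈S , κv≡t

colorMultiset≡0⊎∈ : ∀ {n k} (κ : Fin n → Fin k) (S : Subset n) t →
  colorMultiset κ S t ≡ 0 ⊎ Σ (Fin n) (λ v → v ∈ S × κ v ≡ t)
colorMultiset≡0⊎∈ κ []          t = inj₁ refl
colorMultiset≡0⊎∈ κ (false ∷ S) t = Sum.map₂ witness-suc (colorMultiset≡0⊎∈ (κ ∘ suc) S t)
colorMultiset≡0⊎∈ κ (true ∷ S)  t with κ zero ≟ t | colorMultiset-∷ κ true S t
... | yes κ0≡t | _        = inj₂ (zero , here , κ0≡t)
... | no  _    | split     = Sum.map (trans split) witness-suc (colorMultiset≡0⊎∈ (κ ∘ suc) S t)

SharesColour : ∀ {n k} → (Fin n → Fin k) → Subset n → Subset n → Set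
SharesColour {n} κ S T = Σ (Fin n) λ v₁ → Σ (Fin n) λ v₂ → κ v₁ ≡ κ v₂ × v₁ ∈ S × v₂ ∈ T

‖∩ₘ‖≡0⇔¬SharesColour : ∀ {n k} (κ : Fin n → Fin k) (S T : Subset n) →
  ‖ colorMultiset κ S ∩ₘ colorMultiset κ T ‖ ≡ 0 ⇔ (¬ SharesColour κ S T)
‖∩ₘ‖≡0⇔¬SharesColour κ S T = mk⇔ disjoint⇒¬shared ¬shared⇒disjoint
  where
  disjoint⇒¬shared : ‖ colorMultiset κ S ∩ₘ colorMultiset κ T ‖ ≡ 0 → ¬ SharesColour κ S T
  disjoint⇒¬shared disjoint (v₁ , v₂ , κv₁≡κv₂ , v₁∈S , v₂∈T) =
    Sum.[ (λ Sₜ≡0 → colorMultiset≡0⇒≢ κ Sₜ≡0 v₁∈S κv₁≡κv₂)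
        , (λ Tₜ≡0 → colorMultiset≡0⇒≢ κ Tₜ≡0 v₂∈T refl) ]
      (m⊓n≡0⇒m≡0⊎n≡0 _ _ (sumFin≡0⇒≡0 _ disjoint (κ v₂)))

  ¬shared⇒disjoint : ¬ SharesColour κ S T → ‖ colorMultiset κ S ∩ₘ colorMultiset κ T ‖ ≡ 0
  ¬shared⇒disjoint ¬shared = sumFin-zero disjoint-at
    where
    disjoint-at : ∀ t → colorMultiset κ S t ⊓ colorMultiset κ T t ≡ 0
    disjoint-at t with colorMultiset≡0⊎∈ κ S t | colorMultiset≡0⊎∈ κ T t
    ... | inj₁ Sₜ≡0 | _         = cong (_⊓ colorMultiset κ T t) Sₜ≡0
    ... | inj₂ _    | inj₁ Tₜ≡0 = trans (cong (colorMultiset κ S t ⊓_) Tₜ≡0) (⊓-zeroʳ _)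
    ... | inj₂ (v₁ , v₁∈S , κv₁≡t) | inj₂ (v₂ , v₂∈T , κv₂≡t) =
      ⊥-elim (¬shared (v₁ , v₂ , trans κv₁≡t (sym κv₂≡t) , v₁∈S , v₂∈T))

∈∩∁⇔∈×∉ : ∀ {n} {v : Fin n} {S T : Subset n} → v ∈ S ∩ ∁ T ⇔ (v ∈ S × v ∉ T)
∈∩∁⇔∈×∉ {S = S} {T} = mk⇔
  (λ v∈ → Product.map₂ x∈∁p⇒x∉p (x∈p∩q⁻ S (∁ T) v∈))
  (λ (v∈S , v∉T) → x∈p∩q⁺ (v∈S , x∉p⇒x∈∁p v∉T))

CrossingPair : ∀ {n k} → (Fin n → Fin k) → Subset n → Subset n → Set
CrossingPair {n} κ F F' = Σ (Fin n) λ v₁ → Σ (Fin n) λ v₂ →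
  κ v₁ ≡ κ v₂ × (v₁ ∈ F × v₁ ∉ F') × (v₂ ∈ F' × v₂ ∉ F)

‖∩ₘ‖≡∣∩∣⇔¬crossing : ∀ {n k} (κ : Fin n → Fin k) (F F' : Subset n) →
  ‖ colorMultiset κ F ∩ₘ colorMultiset κ F' ‖ ≡ ∣ F ∩ F' ∣ ⇔ (¬ CrossingPair κ F F')
‖∩ₘ‖≡∣∩∣⇔¬crossing κ F F' = mk⇔
  (λ linear (v₁ , v₂ , κv₁≡κv₂ , v₁∈F∖F' , v₂∈F'∖F) →
     Equivalence.to (‖∩ₘ‖≡0⇔¬SharesColour κ (F ∩ ∁ F') (F' ∩ ∁ F)) (linear⇒excess≡0 linear)
       (v₁ , v₂ , κv₁≡κv₂ , Equivalence.from ∈∩∁⇔∈×∉ v₁∈F∖F' , Equivalence.from ∈∩∁⇔∈×∉ v₂∈F'∖F))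
  (λ ¬crossing → begin
     ‖ colorMultiset κ F ∩ₘ colorMultiset κ F' ‖
       ≡⟨ ‖∩ₘ‖≡∣∩∣+excess κ F F' ⟩
     ∣ F ∩ F' ∣ + ‖ excess ‖
       ≡⟨ cong (∣ F ∩ F' ∣ +_) (Equivalence.from (‖∩ₘ‖≡0⇔¬SharesColour κ (F ∩ ∁ F') (F' ∩ ∁ F))
            λ (v₁ , v₂ , κv₁≡κv₂ , v₁∈ , v₂∈) →
              ¬crossing (v₁ , v₂ , κv₁≡κv₂ , Equivalence.to ∈∩∁⇔∈×∉ v₁∈ , Equivalence.to ∈∩∁⇔∈×∉ v₂∈)) ⟩
     ∣ F ∩ F' ∣ + 0
       ≡⟨ +-identityʳ _ ⟩
     ∣ F ∩ F' ∣
       ∎)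
  where
  excess = colorMultiset κ (F ∩ ∁ F') ∩ₘ colorMultiset κ (F' ∩ ∁ F)
  linear⇒excess≡0 : ‖ colorMultiset κ F ∩ₘ colorMultiset κ F' ‖ ≡ ∣ F ∩ F' ∣ → ‖ excess ‖ ≡ 0
  linear⇒excess≡0 linear = +-cancelˡ-≡ ∣ F ∩ F' ∣ _ 0 (begin
    ∣ F ∩ F' ∣ + ‖ excess ‖                     ≡⟨ ‖∩ₘ‖≡∣∩∣+excess κ F F' ⟨
    ‖ colorMultiset κ F ∩ₘ colorMultiset κ F' ‖ ≡⟨ linear ⟩
    ∣ F ∩ F' ∣                                  ≡⟨ +-identityʳ _ ⟨
    ∣ F ∩ F' ∣ + 0                              ∎)

proposition2p7 : (n k : ℕ) (Δ : SimplicialComplex n) (κ : Fin n → Fin k) →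
    Surjective κ →
    IsLinearColoring k Δ κ ⇔
      (∀ F₁ F₂ → IsFacet Δ F₁ → IsFacet Δ F₂ →
        ¬ (Σ (Fin n) λ v₁ → Σ (Fin n) λ v₂ →
             κ v₁ ≡ κ v₂ × (v₁ ∈ F₁ × v₁ ∉ F₂) × (v₂ ∈ F₂ × v₂ ∉ F₁)))
proposition2p7 n k Δ κ surjective = mk⇔
  (λ (_ , linear) F₁ F₂ F₁-facet F₂-facet →
     Equivalence.to (‖∩ₘ‖≡∣∩∣⇔¬crossing κ F₁ F₂) (linear F₁ F₂ F₁-facet F₂-facet))
  (λ ¬crossing → surjective , λ F₁ F₂ F₁-facet F₂-facet →
     Equivalence.from (‖∩ₘ‖≡∣∩∣⇔¬crossing κ F₁ F₂) (¬crossing F₁ F₂ F₁-facet F₂-facet))
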